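{- Let $G=(V,E)$ be a finite simple graph, let $v\in V$ have degree $1$, and let $w$ be its unique neighbour. Then \[ Q(G;x,y)=(1+x)\,Q(G-v;x,y)+x(y-1)\,Q(G-\{v,w\};x,y). \]
   Context: For $G=(V,E)$, $Q(G;x,y)=\sum_{X\subseteq V}x^{|X|}y^{k(G[X])}$, where $G[X]$ is the induced subgraph and $k$ the number of connected components (the null graph has $k=0$). $G-v$ and $G-\{v,w\}$ denote the graphs obtained by removing the indicated vertices together with their incident edges. -}

module Defs where

open import Data.Bool using (Bool; true; false; _∧_; _∨_; not; if_then_else_)
open import Data.Nat as ℕ using (ℕ; zero; suc; _∸_; _≡ᵇ_; _<ᵇ_)
open import Data.Fin using (Fin; zero; suc; toℕ; punchIn; punchOut)
open import Data.Fin.Properties using (punchIn-injective)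
open import Data.Integer as ℤ using (ℤ; +_)
open import Data.List using (List; []; _∷_; foldr; map; concatMap; upTo)
open import Relation.Binary.PropositionalEquality using (_≡_; _≢_; refl; trans; sym; subst)
open import Data.Empty using (⊥)

record Graph (n : ℕ) : Set where
  field
    adj    : Fin n → Fin n → Bool
    adj-sym    : ∀ i j → adj i j ≡ adj j i
    adj-irrefl : ∀ i → adj i i ≡ false
open Graph public

anyF : ∀ {n} → (Fin n → Bool) → Bool
anyF {zero}  P = false
anyF {suc n} P = P zero ∨ anyF (λ i → P (suc i))

countF : ∀ {n} → (Fin n → Bool) → ℕ
countF {zero}  P = 0
countF {suc n} P = (if P zero then 1 else 0) ℕ.+ countF (λ i → P (suc i))

_==F_ : ∀ {n} → Fin n → Fin n → Bool
i ==F j = toℕ i ≡ᵇ toℕ j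

degree : ∀ {n} → Graph n → Fin n → ℕ
degree G v = countF (adj G v)

_-ᵥ_ : ∀ {n} → Graph (suc n) → Fin (suc n) → Graph n
adj    (G -ᵥ v) a b = adj G (punchIn v a) (punchIn v b)
adj-sym    (G -ᵥ v) a b = adj-sym G (punchIn v a) (punchIn v b)
adj-irrefl (G -ᵥ v) a   = adj-irrefl G (punchIn v a)

adj⇒≢ : ∀ {n} (G : Graph n) {v w : Fin n} → adj G v w ≡ true → v ≢ w
adj⇒≢ G {v} e refl with trans (sym e) (adj-irrefl G v)
... | ()

removeTwo : ∀ {n} → Graph (suc (suc n)) → (v w : Fin (suc (suc n))) → v ≢ w → Graph n
removeTwo G v w v≢w = (G -ᵥ v) -ᵥ punchOut v≢w

VSet : ℕ → Set
VSet n = Fin n → Bool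

size : ∀ {n} → VSet n → ℕ
size = countF

extend : ∀ {n} → Bool → VSet n → VSet (suc n)
extend b S zero    = b
extend b S (suc i) = S i

subsets : (n : ℕ) → List (VSet n)
subsets zero    = (λ ()) ∷ []
subsets (suc n) = concatMap (λ S → extend false S ∷ extend true S ∷ []) (subsets n)

step : ∀ {n} → Graph n → VSet n → VSet n → VSet n
step G X R z = X z ∧ (R z ∨ anyF (λ t → R t ∧ adj G t z))

iterate : ∀ {n} → ℕ → (VSet n → VSet n) → VSet n → VSet n
iterate zero    f R = R
iterate (suc k) f R = iterate k f (f R)

-- vertices reachable from u by a path in G[X] (n closure steps suffice)
reach : ∀ {n} → Graph n → VSet n → Fin n → VSet n
reach {n} G X u = iterate n (step G X) (λ z → X z ∧ (z ==F u))

-- k(G[X]) : number of connected components of the induced subgraph G[X],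
-- counted as the number of vertices of X that are the least vertex of
-- their component.  (The null graph has 0 components.)
components : ∀ {n} → Graph n → VSet n → ℕ
components G X =
  countF (λ u → X u ∧ not (anyF (λ t → (toℕ t <ᵇ toℕ u) ∧ reach G X u t)))

-- Bivariate polynomials (formal power series) over ℤ in x, y,
-- represented by their coefficient functions: p i j = coeff of x^i y^j.

Poly : Set
Poly = ℕ → ℕ → ℤ

_≈ₚ_ : Poly → Poly → Set
p ≈ₚ q = ∀ i j → p i j ≡ q i j

mono : ℕ → ℕ → Poly
mono a b i j = if (a ≡ᵇ i) ∧ (b ≡ᵇ j) then + 1 else + 0

0ₚ 1ₚ xₚ yₚ : Poly
0ₚ _ _ = + 0
1ₚ = mono 0 0
xₚ = mono 1 0
yₚ = mono 0 1

_+ₚ_ _-ₚ_ : Poly → Poly → Poly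
(p +ₚ q) i j = p i j ℤ.+ q i j
(p -ₚ q) i j = p i j ℤ.- q i j

sumℤ : List ℤ → ℤ
sumℤ = foldr ℤ._+_ (+ 0)

_*ₚ_ : Poly → Poly → Poly
(p *ₚ q) i j = sumℤ (map (λ a → sumℤ (map (λ b → p a b ℤ.* q (i ∸ a) (j ∸ b)) (upTo (suc j)))) (upTo (suc i)))

infixl 6 _+ₚ_ _-ₚ_
infixl 7 _*ₚ_
infix 4 _≈ₚ_

sumₚ : List Poly → Poly
sumₚ = foldr _+ₚ_ 0ₚ

Q : ∀ {n} → Graph n → Poly
Q {n} G = sumₚ (map (λ X → mono (size X) (components G X)) (subsets n))

-- Let v be a leaf with neighbour w, H = G - v and K = G - {v,w}.  Writing
-- each X as Y or Y ∪ {v} with Y ⊆ V(H):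
--   * v ∉ X : G[X] = H[Y], so these terms add up to Q(H);
--   * v ∈ X : k(G[X]) = k(H[Y]) if w ∈ Y (v joins the component of w) and
--             k(H[Y]) + 1 otherwise (v is a component of its own).
-- Splitting the second group once more by w ∈ Y and comparing with x Q(H),
-- x Q(K) and x y Q(K) gives Q(G) = (1+x) Q(H) + x(y-1) Q(K).
module Submission where

open import Defs
open import Data.Nat as ℕ using (ℕ; zero; suc; _+_; _∸_; _≤_; z≤n; s≤s; _≡ᵇ_; _<ᵇ_)
open import Data.Nat.Properties using (suc-injective; 0≢1+n; <ᵇ⇒<; <⇒<ᵇ; <-trans; ≡ᵇ⇒≡; ≡⇒≡ᵇ; +-assoc; +-comm; +-suc; ≤-refl; ≤-trans; ≤-reflexive; n≤1+n; +-mono-≤; n≮n)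
open import Data.Integer as ℤ using (ℤ; +_)
open import Data.Integer.Properties using (*-identityˡ) renaming (+-identityˡ to +ℤ-identityˡ; +-identityʳ to +ℤ-identityʳ)
open import Data.Integer.Tactic.RingSolver using (solve-∀)
open import Data.Fin using (Fin; zero; suc; toℕ; punchIn; punchOut)
open import Data.Fin.Properties using (toℕ-injective; _≟_; punchIn-punchOut; punchInᵢ≢i; punchIn-injective)
open import Data.Bool using (Bool; true; false; _∧_; _∨_; not; if_then_else_)
open import Data.Bool.Properties using (∧-zeroʳ; ∧-identityʳ; ∨-comm; ∨-assoc; ∨-zeroʳ; T-≡)
open import Data.List using (List; []; _∷_; map; concatMap; applyUpTo; upTo)
open import Data.List.Properties using (map-upTo)
open import Data.Product using (∃; _,_; _×_)
open import Data.Sum using (_⊎_; inj₁; inj₂)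
open import Data.Empty using (⊥; ⊥-elim)
open import Function.Bundles using (Equivalence)
open import Relation.Nullary using (yes; no)
open import Relation.Binary.Bundles using (Setoid)
import Relation.Binary.Reasoning.Setoid
open import Relation.Binary.PropositionalEquality

private
  variable
    m n : ℕ

indicator : Bool → ℕ
indicator b = if b then 1 else 0

bool-ext : ∀ {a b : Bool} → (a ≡ true → b ≡ true) → (b ≡ true → a ≡ true) → a ≡ b
bool-ext {true}  {true}  _ _ = refl
bool-ext {true}  {false} f _ = sym (f refl)
bool-ext {false} {true}  _ g = g refl
bool-ext {false} {false} _ _ = refl

∧-left : ∀ {a b} → a ∧ b ≡ true → a ≡ true
∧-left {true} _ = refl

∧-right : ∀ {a b} → a ∧ b ≡ true → b ≡ true
∧-right {true} e = e

not-true : ∀ {a} → not a ≡ true → a ≡ false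
not-true {false} _ = refl

true≢false : true ≡ false → ⊥
true≢false ()

false-unless : ∀ {a} → (a ≡ true → ⊥) → a ≡ false
false-unless {true}  f = ⊥-elim (f refl)
false-unless {false} _ = refl

countF-punchIn : (v : Fin (suc m)) (P : Fin (suc m) → Bool) →
  countF P ≡ indicator (P v) + countF (λ i → P (punchIn v i))
countF-punchIn zero P = refl
countF-punchIn {suc m} (suc v) P
  rewrite countF-punchIn v (λ i → P (suc i))
        | sym (+-assoc (indicator (P zero)) (indicator (P (suc v))) (countF (λ i → P (suc (punchIn v i)))))
        | +-comm (indicator (P zero)) (indicator (P (suc v)))
  = +-assoc (indicator (P (suc v))) _ _

anyF-punchIn : (v : Fin (suc m)) (P : Fin (suc m) → Bool) →
  anyF P ≡ P v ∨ anyF (λ i → P (punchIn v i))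
anyF-punchIn zero P = refl
anyF-punchIn {suc m} (suc v) P
  rewrite anyF-punchIn v (λ i → P (suc i))
        | sym (∨-assoc (P zero) (P (suc v)) (anyF (λ i → P (suc (punchIn v i)))))
        | ∨-comm (P zero) (P (suc v))
  = ∨-assoc (P (suc v)) _ _

countF-cong : {P R : Fin m → Bool} → (∀ i → P i ≡ R i) → countF P ≡ countF R
countF-cong {zero}  e = refl
countF-cong {suc m} e = cong₂ _+_ (cong indicator (e zero)) (countF-cong (λ i → e (suc i)))

anyF-cong : {P R : Fin m → Bool} → (∀ i → P i ≡ R i) → anyF P ≡ anyF R
anyF-cong {zero}  e = refl
anyF-cong {suc m} e = cong₂ _∨_ (e zero) (anyF-cong (λ i → e (suc i)))

anyF-witness : (P : Fin m → Bool) → anyF P ≡ true → ∃ λ i → P i ≡ true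
anyF-witness {suc m} P e with P zero in p₀
... | true  = zero , p₀
... | false with anyF-witness (λ i → P (suc i)) e
...   | i , p = suc i , p

anyF-intro : (P : Fin m → Bool) (i : Fin m) → P i ≡ true → anyF P ≡ true
anyF-intro P zero    p rewrite p = refl
anyF-intro P (suc i) p with P zero
... | true  = refl
... | false = anyF-intro (λ i → P (suc i)) i p

anyF-none : (P : Fin m → Bool) → (∀ i → P i ≡ false) → anyF P ≡ false
anyF-none {zero}  P h = refl
anyF-none {suc m} P h rewrite h zero = anyF-none (λ i → P (suc i)) (λ i → h (suc i))

countF-none : (P : Fin m → Bool) → (∀ i → P i ≡ false) → countF P ≡ 0
countF-none {zero}  P h = refl
countF-none {suc m} P h rewrite h zero = countF-none (λ i → P (suc i)) (λ i → h (suc i))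

countF-member : (P : Fin m → Bool) (i : Fin m) → P i ≡ true → countF P ≡ 0 → ⊥
countF-member {suc m} P i p none =
  0≢1+n (trans (sym none) (trans (countF-punchIn i P) (cong (λ a → indicator a + countF (λ j → P (punchIn i j))) p)))

countF-split : (P R : Fin m → Bool) →
  countF P ≡ countF (λ i → P i ∧ not (R i)) + countF (λ i → P i ∧ R i)
countF-split {zero}  P R = refl
countF-split {suc m} P R
  rewrite countF-split (λ i → P (suc i)) (λ i → R (suc i)) with P zero | R zero
... | false | _     = refl
... | true  | false = refl
... | true  | true  = sym (+-suc _ _)

Every : (Fin n → Set) → VSet n → Set
Every P A = ∀ z → A z ≡ true → P z

_⊆_ : VSet n → VSet n → Set
A ⊆ B = Every (λ z → B z ≡ true) A

indicator-mono : ∀ {a b} → (a ≡ true → b ≡ true) → indicator a ≤ indicator b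
indicator-mono {false} _ = z≤n
indicator-mono {true}  f rewrite f refl = ≤-refl

countF-mono : {A B : VSet n} → A ⊆ B → countF A ≤ countF B
countF-mono {zero}  h = z≤n
countF-mono {suc n} h = +-mono-≤ (indicator-mono (h zero)) (countF-mono (λ z → h (suc z)))

countF-strict : {A B : VSet n} → A ⊆ B → ∀ z → B z ≡ true → A z ≡ false → suc (countF A) ≤ countF B
countF-strict {suc n} {A} {B} h zero    b a rewrite b | a = s≤s (countF-mono (λ z → h (suc z)))
countF-strict {suc n} {A} {B} h (suc z) b a =
  ≤-trans (≤-reflexive (sym (+-suc (indicator (A zero)) _)))
          (+-mono-≤ (indicator-mono (h zero))
                    (countF-strict (λ z → h (suc z)) z b a))

countF≤ : (A : VSet n) → countF A ≤ n
countF≤ {zero}  A = z≤n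
countF≤ {suc n} A with A zero
... | true  = s≤s (countF≤ (λ i → A (suc i)))
... | false = ≤-trans (countF≤ (λ i → A (suc i))) (n≤1+n n)

countF-full : (A : VSet n) → n ≤ countF A → ∀ z → A z ≡ true
countF-full {suc n} A c z with A zero in a₀
countF-full {suc n} A (s≤s c) zero    | true = a₀
countF-full {suc n} A (s≤s c) (suc z) | true = countF-full (λ i → A (suc i)) c z
... | false = ⊥-elim (n≮n n (≤-trans c (countF≤ (λ i → A (suc i)))))

-- Kleene iteration: a monotone, inflationary map on the finite lattice
-- of subsets of Fin n reaches a post-fixed point after n steps, since
-- every non-stationary step adds an element.

Monotone : (VSet n → VSet n) → Set
Monotone f = ∀ {A B} → A ⊆ B → f A ⊆ f B

-- iterate applies f to its argument first; one more step applies f last.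
iterate-suc : ∀ j (f : VSet n → VSet n) R → iterate (suc j) f R ≡ f (iterate j f R)
iterate-suc zero    f R = refl
iterate-suc (suc j) f R = iterate-suc j f (f R)

iterate-every : ∀ j (f : VSet n → VSet n) (P : Fin n → Set) →
  (∀ A → Every P A → Every P (f A)) → ∀ R → Every P R → Every P (iterate j f R)
iterate-every zero    f P preserved R p = p
iterate-every (suc j) f P preserved R p = iterate-every j f P preserved (f R) (preserved R p)

module KleeneChain (f : VSet n → VSet n) (f-mono : Monotone f) (R : VSet n) (R⊆fR : R ⊆ f R) where

  chain : ℕ → VSet n
  chain j = iterate j f R

  chain-suc : ∀ j → chain (suc j) ≡ f (chain j)
  chain-suc j = iterate-suc j f R

  ascending : ∀ j → chain j ⊆ chain (suc j)
  ascending zero    = R⊆fR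
  ascending (suc j) = subst₂ _⊆_ (sym (chain-suc j)) (sym (chain-suc (suc j))) (f-mono (ascending j))

  inflating : ∀ j → R ⊆ chain j
  inflating zero    z r = r
  inflating (suc j) z r = ascending j z (inflating j z r)

  post-fixed-next : ∀ j → f (chain j) ⊆ chain j → f (chain (suc j)) ⊆ chain (suc j)
  post-fixed-next j pf = subst (λ A → f A ⊆ A) (sym (chain-suc j)) (f-mono pf)

  grows-or-stable : ∀ j → j ≤ countF (chain j) ⊎ f (chain j) ⊆ chain j
  grows-or-stable zero = inj₁ z≤n
  grows-or-stable (suc j) with grows-or-stable j
  ... | inj₂ pf = inj₂ (post-fixed-next j pf)
  ... | inj₁ c with anyF (λ z → chain (suc j) z ∧ not (chain j z)) in new
  ...   | true = let (z , p) = anyF-witness _ new in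
                 inj₁ (≤-trans (s≤s c) (countF-strict (ascending j) z (∧-left p) (not-true (∧-right p))))
  ...   | false = inj₂ (post-fixed-next j (subst (λ A → A ⊆ chain j) (chain-suc j) stuck))
    where
    stuck : chain (suc j) ⊆ chain j
    stuck z p with chain j z in q
    ... | true  = refl
    ... | false = ⊥-elim (true≢false (trans (sym (anyF-intro _ z (cong₂ (λ a b → a ∧ not b) p q))) new))

  post-fixed : f (chain n) ⊆ chain n
  post-fixed with grows-or-stable n
  ... | inj₁ c  = λ z _ → countF-full (chain n) c z
  ... | inj₂ pf = pf

-- Reachability inside an induced subgraph G[X].

data Reach (G : Graph n) (X : VSet n) (u : Fin n) : Fin n → Set where
  here  : X u ≡ true → Reach G X u u
  there : ∀ {t z} → Reach G X u t → X z ≡ true → adj G t z ≡ true → Reach G X u z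

module _ {G : Graph n} {X : VSet n} where

  Reach-target : ∀ {u z} → Reach G X u z → X z ≡ true
  Reach-target (here x)      = x
  Reach-target (there _ x _) = x

  Reach-source : ∀ {u z} → Reach G X u z → X u ≡ true
  Reach-source (here x)      = x
  Reach-source (there r _ _) = Reach-source r

  Reach-trans : ∀ {a b c} → Reach G X a b → Reach G X b c → Reach G X a c
  Reach-trans r (here _)      = r
  Reach-trans r (there s x e) = there (Reach-trans r s) x e

  Reach-sym : ∀ {a b} → Reach G X a b → Reach G X b a
  Reach-sym (here x) = here x
  Reach-sym (there {t} {z} r x e) =
    Reach-trans (there (here x) (Reach-target r) (trans (adj-sym G z t) e)) (Reach-sym r)

==F-sound : {u z : Fin n} → (z ==F u) ≡ true → z ≡ u
==F-sound {u = u} {z} e = toℕ-injective (≡ᵇ⇒≡ (toℕ z) (toℕ u) (Equivalence.from T-≡ e))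

==F-refl : (u : Fin n) → (u ==F u) ≡ true
==F-refl u = Equivalence.to T-≡ (≡⇒≡ᵇ (toℕ u) (toℕ u) refl)

-- The closure step used by reach is monotone, so reach is a Kleene chain.
step-mono : (G : Graph n) (X : VSet n) → Monotone (step G X)
step-mono G X {A} {B} A⊆B z e with X z
... | false = e
... | true with A z in a
...   | true  rewrite A⊆B z a = refl
...   | false = let (t , p) = anyF-witness _ e in
                trans (cong (B z ∨_) (anyF-intro _ t (cong₂ _∧_ (A⊆B t (∧-left p)) (∧-right p))))
                      (∨-zeroʳ (B z))

step-inflating : (G : Graph n) (X A : VSet n) → A ⊆ X → A ⊆ step G X A
step-inflating G X A A⊆X z a rewrite A⊆X z a | a = refl

module _ (G : Graph n) (X : VSet n) (u : Fin n) where

  private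
    seed : VSet n
    seed z = X z ∧ (z ==F u)

    open KleeneChain (step G X) (step-mono G X) seed
                     (step-inflating G X seed (λ z → ∧-left))

  reach-sound : ∀ {t} → reach G X u t ≡ true → Reach G X u t
  reach-sound {t} = iterate-every n (step G X) (Reach G X u) walk-extends seed walk-seed t
    where
    walk-seed : Every (Reach G X u) seed
    walk-seed z e with ==F-sound {u = u} {z} (∧-right e)
    ... | refl = here (∧-left e)
    walk-extends : ∀ A → Every (Reach G X u) A → Every (Reach G X u) (step G X A)
    walk-extends A walks z e with X z in x | A z in a
    ... | true | true  = walks z a
    ... | true | false = let (t , p) = anyF-witness (λ t → A t ∧ adj G t z) e in
                         there (walks t (∧-left p)) x (∧-right p)

  reach-complete : ∀ {t} → Reach G X u t → reach G X u t ≡ true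
  reach-complete (here x) = inflating n u (cong₂ _∧_ x (==F-refl u))
  reach-complete (there {t} {z} r x e) =
    post-fixed z (cong₂ _∧_ x (trans (cong (chain n z ∨_) (anyF-intro _ t (cong₂ _∧_ (reach-complete r) e)))
                                     (∨-zeroʳ (chain n z))))

module _ {G : Graph n} {X : VSet n} where

  reach-sym : ∀ a b → reach G X a b ≡ reach G X b a
  reach-sym a b = bool-ext (λ r → reach-complete G X b (Reach-sym (reach-sound G X a r)))
                           (λ r → reach-complete G X a (Reach-sym (reach-sound G X b r)))

  reach-trans : ∀ {a b c} → reach G X a b ≡ true → reach G X b c ≡ true → reach G X a c ≡ true
  reach-trans r s = reach-complete G X _ (Reach-trans (reach-sound G X _ r) (reach-sound G X _ s))

  reach-source : ∀ {a b} → reach G X a b ≡ true → X a ≡ true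
  reach-source r = Reach-source (reach-sound G X _ r)

-- Subsets of Fin (suc m) as a subset of Fin m plus a decision at v.
-- ins is built from extend, so that it matches the enumeration subsets.

ins : Fin (suc m) → Bool → VSet m → VSet (suc m)
ins zero            b Y = extend b Y
ins {suc m} (suc v) b Y = extend (Y zero) (ins v b (λ i → Y (suc i)))

ins-at : (v : Fin (suc m)) (b : Bool) (Y : VSet m) → ins v b Y v ≡ b
ins-at zero            b Y = refl
ins-at {suc m} (suc v) b Y = ins-at v b (λ i → Y (suc i))

ins-punchIn : (v : Fin (suc m)) (b : Bool) (Y : VSet m) (i : Fin m) → ins v b Y (punchIn v i) ≡ Y i
ins-punchIn zero            b Y i       = refl
ins-punchIn {suc m} (suc v) b Y zero    = refl
ins-punchIn {suc m} (suc v) b Y (suc i) = ins-punchIn v b (λ i → Y (suc i)) i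

size-ins : (v : Fin (suc m)) (b : Bool) (Y : VSet m) → size (ins v b Y) ≡ indicator b + size Y
size-ins v b Y = trans (countF-punchIn v (ins v b Y))
                       (cong₂ _+_ (cong indicator (ins-at v b Y)) (countF-cong (ins-punchIn v b Y)))

-- Counting classes of a relation by their least elements.

lt : Fin n → Fin n → Bool
lt a b = toℕ a <ᵇ toℕ b

lt-irrefl : (a : Fin n) → lt a a ≡ false
lt-irrefl a = irrefl (toℕ a)
  where
  irrefl : ∀ k → (k <ᵇ k) ≡ false
  irrefl zero    = refl
  irrefl (suc k) = irrefl k

lt-trans : {a b c : Fin n} → lt a b ≡ true → lt b c ≡ true → lt a c ≡ true
lt-trans {a = a} {b} {c} p q = Equivalence.to T-≡ (<⇒<ᵇ (<-trans
  (<ᵇ⇒< (toℕ a) (toℕ b) (Equivalence.from T-≡ p)) (<ᵇ⇒< (toℕ b) (toℕ c) (Equivalence.from T-≡ q))))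

lt-punchIn : (v : Fin (suc m)) (i j : Fin m) → lt (punchIn v i) (punchIn v j) ≡ lt i j
lt-punchIn zero            i       j       = refl
lt-punchIn {suc m} (suc v) zero    zero    = refl
lt-punchIn {suc m} (suc v) zero    (suc j) = refl
lt-punchIn {suc m} (suc v) (suc i) zero    = refl
lt-punchIn {suc m} (suc v) (suc i) (suc j) = lt-punchIn v i j

above : Fin (suc m) → Fin m → Bool
above v j = lt v (punchIn v j)

lt-punchIn-below : (v : Fin (suc m)) (j : Fin m) → lt (punchIn v j) v ≡ not (above v j)
lt-punchIn-below zero            j       = refl
lt-punchIn-below {suc m} (suc v) zero    = refl
lt-punchIn-below {suc m} (suc v) (suc j) = lt-punchIn-below v j

BRel : ℕ → Set
BRel n = Fin n → Fin n → Bool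

-- For
-- the reachability relation of G[X] these are the least vertices of the
-- components, so components G X is leaders X (reach G X) by definition.
leaders : VSet n → BRel n → ℕ
leaders X R = countF (λ u → X u ∧ not (anyF (λ t → lt t u ∧ R u t)))

Restricts : Fin (suc m) → BRel (suc m) → BRel m → Set
Restricts v R R' = ∀ a c → R (punchIn v a) (punchIn v c) ≡ R' a c

leaders-split : (v : Fin (suc m)) (b : Bool) (Y : VSet m) (R : BRel (suc m)) (R' : BRel m) →
  Restricts v R R' →
  leaders (ins v b Y) R ≡
    indicator (b ∧ not (anyF (λ j → not (above v j) ∧ R v (punchIn v j))))
    + countF (λ i → Y i ∧ not ((above v i ∧ R (punchIn v i) v) ∨ anyF (λ j → lt j i ∧ R' i j)))
leaders-split v b Y R R' restricts =
  trans (countF-punchIn v leader) (cong₂ _+_ (cong indicator v-status) (countF-cong other-status))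
  where
  leader : Fin _ → Bool
  leader u = ins v b Y u ∧ not (anyF (λ t → lt t u ∧ R u t))

  v-status : leader v ≡ b ∧ not (anyF (λ j → not (above v j) ∧ R v (punchIn v j)))
  v-status = cong₂ (λ x a → x ∧ not a) (ins-at v b Y)
    (trans (anyF-punchIn v (λ t → lt t v ∧ R v t))
           (cong₂ _∨_ (cong (_∧ R v v) (lt-irrefl v))
                      (anyF-cong (λ j → cong (_∧ R v (punchIn v j)) (lt-punchIn-below v j)))))

  other-status : ∀ i → leader (punchIn v i) ≡
    Y i ∧ not ((above v i ∧ R (punchIn v i) v) ∨ anyF (λ j → lt j i ∧ R' i j))
  other-status i = cong₂ (λ x a → x ∧ not a) (ins-punchIn v b Y i)
    (trans (anyF-punchIn v (λ t → lt t (punchIn v i) ∧ R (punchIn v i) t))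
           (cong ((above v i ∧ R (punchIn v i) v) ∨_)
                 (anyF-cong (λ j → cong₂ _∧_ (lt-punchIn v j i) (restricts i j)))))

leaders-isolated : (v : Fin (suc m)) (b : Bool) (Y : VSet m) (R : BRel (suc m)) (R' : BRel m) →
  Restricts v R R' → (∀ j → R (punchIn v j) v ≡ false) → (∀ j → R v (punchIn v j) ≡ false) →
  leaders (ins v b Y) R ≡ indicator b + leaders Y R'
leaders-isolated v b Y R R' restricts into out-of = trans (leaders-split v b Y R R' restricts)
  (cong₂ _+_
    (cong indicator (trans (cong (λ a → b ∧ not a)
      (anyF-none _ (λ j → trans (cong (not (above v j) ∧_) (out-of j)) (∧-zeroʳ _)))) (∧-identityʳ b)))
    (countF-cong (λ i → cong (λ r → Y i ∧ not (r ∨ anyF (λ j → lt j i ∧ R' i j)))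
      (trans (cong (above v i ∧_) (into i)) (∧-zeroʳ _)))))

least : (Fin n → Bool) → Fin n → Bool
least P i = P i ∧ not (anyF (λ j → lt j i ∧ P j))

UpwardClosed : (Fin n → Bool) → Set
UpwardClosed Q = ∀ i j → Q i ≡ true → lt i j ≡ true → Q j ≡ true

least-in-upper : (P Q : Fin n → Bool) → UpwardClosed Q → anyF P ≡ true →
  countF (λ i → least P i ∧ Q i) ≡ indicator (not (anyF (λ j → not (Q j) ∧ P j)))
least-in-upper {suc n} P Q upward nonempty with P zero in p₀
... | false rewrite ∧-zeroʳ (not (Q zero)) =
  least-in-upper (λ i → P (suc i)) (λ i → Q (suc i)) (λ i j → upward (suc i) (suc j)) nonempty
-- zero is the least element of P, and nothing else is
... | true rewrite anyF-none {n} (λ _ → false) (λ _ → refl)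
                 | countF-none (λ i → (P (suc i) ∧ false) ∧ Q (suc i)) (λ i → cong (_∧ Q (suc i)) (∧-zeroʳ (P (suc i))))
                 with Q zero in q₀
...   | false = refl
...   | true rewrite anyF-none (λ j → not (Q (suc j)) ∧ P (suc j))
                               (λ j → cong (λ q → not q ∧ P (suc j)) (upward zero (suc j) q₀ refl)) = refl

exclude-both : ∀ y a r → (y ∧ not a) ∧ not r ≡ y ∧ not (r ∨ a)
exclude-both false a     r     = refl
exclude-both true  true  true  = refl
exclude-both true  true  false = refl
exclude-both true  false true  = refl
exclude-both true  false false = refl

-- Of the class that v joins, exactly
-- one of v and the old least element is a leader.
leaders-absorbed : (v : Fin (suc m)) (Y : VSet m) (R : BRel (suc m)) (R' : BRel m) →
  Restricts v R R' →
  (∀ a b → R a b ≡ R b a) →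
  (∀ {a b c} → R a b ≡ true → R b c ≡ true → R a c ≡ true) →
  (∀ {a b} → R a b ≡ true → ins v true Y a ≡ true) →
  (c : Fin m) → R v (punchIn v c) ≡ true →
  leaders (ins v true Y) R ≡ leaders Y R'
leaders-absorbed v Y R R' restricts R-sym R-trans support c vc = begin
  leaders (ins v true Y) R
    ≡⟨ leaders-split v true Y R R' restricts ⟩
  joined + countF (λ i → Y i ∧ not (into i ∨ rest i))
    ≡⟨ +-comm joined _ ⟩
  countF (λ i → Y i ∧ not (into i ∨ rest i)) + joined
    ≡⟨ sym (cong₂ _+_ (countF-cong (λ i → exclude-both (Y i) (rest i) (into i)))
                      (trans (countF-cong class-leader)
                             (least-in-upper P (above v) upward (anyF-intro P c vc)))) ⟩
  countF (λ i → (Y i ∧ not (rest i)) ∧ not (into i)) + countF (λ i → (Y i ∧ not (rest i)) ∧ into i)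
    ≡⟨ sym (countF-split (λ i → Y i ∧ not (rest i)) into) ⟩
  leaders Y R' ∎
  where
  open ≡-Reasoning
  -- the class of v, seen from the other vertices
  P : Fin _ → Bool
  P j = R v (punchIn v j)
  into : Fin _ → Bool
  into i = above v i ∧ R (punchIn v i) v
  rest : Fin _ → Bool
  rest i = anyF (λ j → lt j i ∧ R' i j)
  joined : ℕ
  joined = indicator (not (anyF (λ j → not (above v j) ∧ P j)))

  upward : UpwardClosed (above v)
  upward i j v<i i<j = lt-trans {a = v} {punchIn v i} {punchIn v j} v<i (trans (lt-punchIn v i j) i<j)

  same-class : ∀ {i} → R (punchIn v i) v ≡ true → ∀ j → R' i j ≡ P j
  same-class {i} r j = trans (sym (restricts i j))
    (bool-ext (R-trans (trans (R-sym v (punchIn v i)) r)) (R-trans r))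

  class-leader : ∀ i → (Y i ∧ not (rest i)) ∧ into i ≡ least P i ∧ above v i
  class-leader i with R (punchIn v i) v in r
  ... | false = trans (cong ((Y i ∧ not (rest i)) ∧_) (∧-zeroʳ (above v i)))
                 (trans (∧-zeroʳ _) (cong (λ p → (p ∧ not (anyF (λ j → lt j i ∧ P j))) ∧ above v i)
                                          (sym (trans (R-sym v (punchIn v i)) r))))
  ... | true rewrite ∧-identityʳ (above v i)
                   | trans (sym (ins-punchIn v true Y i)) (support r)
                   | trans (R-sym v (punchIn v i)) r
                   | anyF-cong {P = λ j → lt j i ∧ R' i j} (λ j → cong (lt j i ∧_) (same-class r j)) = refl

-- Deleting a vertex v.  Walks of (G - v)[Y] are the walks of G[ins v b Y]
-- that avoid v; when v has at most one neighbour, a walk passing through v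
-- enters and leaves it by the same neighbour and can be short-cut.

data Position (v : Fin (suc m)) : Fin (suc m) → Set where
  at-v     : Position v v
  beside-v : (c : Fin m) → Position v (punchIn v c)

position : (v t : Fin (suc m)) → Position v t
position v t with v ≟ t
... | yes refl = at-v
... | no  v≢t  = subst (Position v) (punchIn-punchOut v≢t) (beside-v (punchOut v≢t))

module DeleteVertex (G : Graph (suc m)) (v : Fin (suc m)) (b : Bool) (Y : VSet m) where

  private
    X : VSet (suc m)
    X = ins v b Y
    H : Graph m
    H = G -ᵥ v

  lift : ∀ {a c} → Reach H Y a c → Reach G X (punchIn v a) (punchIn v c)
  lift {a} (here y)              = here (trans (ins-punchIn v b Y a) y)
  lift (there {z = z} r y e)     = there (lift r) (trans (ins-punchIn v b Y z) y) e

  AtMostOneNeighbour : Set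
  AtMostOneNeighbour = X v ≡ true →
    ∀ s t → adj G v (punchIn v s) ≡ true → adj G v (punchIn v t) ≡ true → s ≡ t

  data Shadow (a : Fin m) : Fin (suc m) → Set where
    via-neighbour : ∀ {c} → adj G v (punchIn v c) ≡ true → Reach H Y a c → Shadow a v
    directly      : ∀ {c} → Reach H Y a c → Shadow a (punchIn v c)

  shadow : AtMostOneNeighbour → ∀ {a y} → Reach G X (punchIn v a) y → Shadow a y
  shadow one {a} (here x) = directly (here (trans (sym (ins-punchIn v b Y a)) x))
  shadow one (there {t} {z} r x e) with shadow one r | position v z
  ... | directly {c} s     | at-v       = via-neighbour (trans (adj-sym G v (punchIn v c)) e) s
  ... | directly s         | beside-v c = directly (there s (trans (sym (ins-punchIn v b Y c)) x) e)
  ... | via-neighbour _ _  | at-v       = ⊥-elim (true≢false (trans (sym e) (adj-irrefl G v)))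
  ... | via-neighbour {c'} e' s | beside-v c =
        directly (subst (Reach H Y _) (one (Reach-target r) c' c e' e) s)

  reach-delete : AtMostOneNeighbour → ∀ a c → reach G X (punchIn v a) (punchIn v c) ≡ reach H Y a c
  reach-delete one a c = bool-ext
    (λ r → reach-complete H Y a (avoid (shadow one (reach-sound G X _ r)) refl))
    (λ r → reach-complete G X _ (lift (reach-sound H Y a r)))
    where
    avoid : ∀ {y} → Shadow a y → y ≡ punchIn v c → Reach H Y a c
    avoid (via-neighbour _ _) eq = ⊥-elim (punchInᵢ≢i v c (sym eq))
    avoid (directly s)        eq = subst (Reach H Y a) (punchIn-injective v _ c eq) s

  enter-v : AtMostOneNeighbour → ∀ {a} → Reach G X (punchIn v a) v →
    ∃ λ c → adj G v (punchIn v c) ≡ true × Reach H Y a c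
  enter-v one r = entry (shadow one r) refl
    where
    entry : ∀ {a y} → Shadow a y → y ≡ v → ∃ λ c → adj G v (punchIn v c) ≡ true × Reach H Y a c
    entry (via-neighbour e s) _  = _ , e , s
    entry (directly s)        eq = ⊥-elim (punchInᵢ≢i v _ eq)

components-absent : (G : Graph (suc m)) (v : Fin (suc m)) (Y : VSet m) →
  components G (ins v false Y) ≡ components (G -ᵥ v) Y
components-absent {m} G v Y = leaders-isolated v false Y (reach G X) (reach (G -ᵥ v) Y)
  (reach-delete absent) (λ j → v-unreachable) (λ j → trans (reach-sym {G = G} {X} v _) v-unreachable)
  where
  open DeleteVertex G v false Y
  X : VSet (suc m)
  X = ins v false Y
  absent : AtMostOneNeighbour
  absent x = ⊥-elim (true≢false (trans (sym x) (ins-at v false Y)))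
  v-unreachable : ∀ {a} → reach G X a v ≡ false
  v-unreachable = false-unless λ g → true≢false (trans (sym (Reach-target (reach-sound G X _ g))) (ins-at v false Y))

leaf-neighbour : (G : Graph (suc n)) (v w : Fin (suc n)) → degree G v ≡ 1 → adj G v w ≡ true →
  ∀ z → adj G v z ≡ true → z ≡ w
leaf-neighbour G v w deg e z ez with position w z
... | at-v       = refl
... | beside-v c = ⊥-elim (countF-member (λ i → adj G v (punchIn w i)) c ez no-other)
  where
  no-other : countF (λ i → adj G v (punchIn w i)) ≡ 0
  no-other = suc-injective (trans (sym (trans (countF-punchIn w (adj G v)) (cong (_+ others) (cong indicator e)))) deg)
    where
    others : ℕ
    others = countF (λ i → adj G v (punchIn w i))

module LeafVertex (G : Graph (suc m)) (v w : Fin (suc m)) (deg : degree G v ≡ 1) (e : adj G v w ≡ true) where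

  w' : Fin m
  w' = punchOut (adj⇒≢ G e)

  w'-is-w : punchIn v w' ≡ w
  w'-is-w = punchIn-punchOut (adj⇒≢ G e)

  neighbour-is-w' : ∀ {c} → adj G v (punchIn v c) ≡ true → c ≡ w'
  neighbour-is-w' {c} ec = punchIn-injective v c w' (trans (leaf-neighbour G v w deg e _ ec) (sym w'-is-w))

  module _ (Y : VSet m) where

    open DeleteVertex G v true Y

    private
      X : VSet (suc m)
      X = ins v true Y

    leaf : AtMostOneNeighbour
    leaf _ s t es et = trans (neighbour-is-w' es) (sym (neighbour-is-w' et))

    components-leaf : components G (ins v true Y) ≡ indicator (not (Y w')) + components (G -ᵥ v) Y
    components-leaf with Y w' in w∈Y
    ... | false = leaders-isolated v true Y (reach G X) (reach (G -ᵥ v) Y) (reach-delete leaf)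
                    (λ j → v-isolated) (λ j → trans (reach-sym {G = G} {X} v _) v-isolated)
      where
      -- a walk into v would arrive from w, which is missing
      v-isolated : ∀ {a} → reach G X (punchIn v a) v ≡ false
      v-isolated = false-unless λ r → let (c , ec , s) = enter-v leaf (reach-sound G X _ r) in
        true≢false (trans (sym (Reach-target s)) (trans (cong Y (neighbour-is-w' ec)) w∈Y))
    ... | true = leaders-absorbed v Y (reach G X) (reach (G -ᵥ v) Y) (reach-delete leaf)
                   (reach-sym {G = G} {X}) (reach-trans {G = G} {X}) (reach-source {G = G} {X}) w' v-joins-w
      where
      v-joins-w : reach G X v (punchIn v w') ≡ true
      v-joins-w = reach-complete G X v (there (here (ins-at v true Y)) (trans (ins-punchIn v true Y w') w∈Y)
                                              (trans (cong (adj G v) w'-is-w) e))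

≈ₚ-setoid : Setoid _ _
≈ₚ-setoid = record
  { Carrier       = Poly
  ; _≈_           = _≈ₚ_
  ; isEquivalence = record
    { refl  = λ i j → refl
    ; sym   = λ p≈q i j → sym (p≈q i j)
    ; trans = λ p≈q q≈r i j → trans (p≈q i j) (q≈r i j)
    }
  }

+ₚ-cong : ∀ {p p' q q'} → p ≈ₚ p' → q ≈ₚ q' → p +ₚ q ≈ₚ p' +ₚ q'
+ₚ-cong p≈p' q≈q' i j = cong₂ ℤ._+_ (p≈p' i j) (q≈q' i j)

-ₚ-cong : ∀ {p p' q q'} → p ≈ₚ p' → q ≈ₚ q' → p -ₚ q ≈ₚ p' -ₚ q'
-ₚ-cong p≈p' q≈q' i j = cong₂ ℤ._-_ (p≈p' i j) (q≈q' i j)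

mono-cong : ∀ {a a' b b'} → a ≡ a' → b ≡ b' → mono a b ≈ₚ mono a' b'
mono-cong a≡a' b≡b' i j = cong₂ (λ a b → mono a b i j) a≡a' b≡b'

ℤ-interchange : ∀ a b c d → (a ℤ.+ b) ℤ.+ (c ℤ.+ d) ≡ (a ℤ.+ c) ℤ.+ (b ℤ.+ d)
ℤ-interchange = solve-∀

open Setoid ≈ₚ-setoid using () renaming (refl to ≈ₚ-refl; sym to ≈ₚ-sym; trans to ≈ₚ-trans)

module ≈ₚ-Reasoning = Relation.Binary.Reasoning.Setoid ≈ₚ-setoid

Σ< : ℕ → (ℕ → ℤ) → ℤ
Σ< n g = sumℤ (applyUpTo g n)

Σ<-cong : ∀ n {f g : ℕ → ℤ} → (∀ k → f k ≡ g k) → Σ< n f ≡ Σ< n g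
Σ<-cong zero    e = refl
Σ<-cong (suc n) e = cong₂ ℤ._+_ (e 0) (Σ<-cong n (λ k → e (suc k)))

Σ<-zero : ∀ n → Σ< n (λ _ → + 0) ≡ + 0
Σ<-zero zero    = refl
Σ<-zero (suc n) = trans (+ℤ-identityˡ _) (Σ<-zero n)

Σ<-+ : ∀ n (f g : ℕ → ℤ) → Σ< n (λ k → f k ℤ.+ g k) ≡ Σ< n f ℤ.+ Σ< n g
Σ<-+ zero    f g = refl
Σ<-+ (suc n) f g rewrite Σ<-+ n (λ k → f (suc k)) (λ k → g (suc k)) =
  ℤ-interchange (f 0) (g 0) (Σ< n (λ k → f (suc k))) (Σ< n (λ k → g (suc k)))

Σ<-diff : ∀ n (f g : ℕ → ℤ) → Σ< n (λ k → f k ℤ.- g k) ≡ Σ< n f ℤ.- Σ< n g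
Σ<-diff zero    f g = refl
Σ<-diff (suc n) f g rewrite Σ<-diff n (λ k → f (suc k)) (λ k → g (suc k)) =
  interchange (f 0) (g 0) (Σ< n (λ k → f (suc k))) (Σ< n (λ k → g (suc k)))
  where
  interchange : ∀ a b c d → (a ℤ.- b) ℤ.+ (c ℤ.- d) ≡ (a ℤ.+ c) ℤ.- (b ℤ.+ d)
  interchange = solve-∀

Σ<-guard : ∀ n (c : Bool) (g : ℕ → ℤ) → Σ< n (λ k → if c then g k else + 0) ≡ (if c then Σ< n g else + 0)
Σ<-guard n true  g = refl
Σ<-guard n false g = Σ<-zero n

-- shiftℕ a h is the coefficient sequence of x^a · h.
shiftℕ : ℕ → (ℕ → ℤ) → ℕ → ℤ
shiftℕ zero    h i       = h i
shiftℕ (suc a) h zero    = + 0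
shiftℕ (suc a) h (suc i) = shiftℕ a h i

shiftℕ-cong : ∀ a {f g : ℕ → ℤ} → (∀ k → f k ≡ g k) → ∀ i → shiftℕ a f i ≡ shiftℕ a g i
shiftℕ-cong zero    e i       = e i
shiftℕ-cong (suc a) e zero    = refl
shiftℕ-cong (suc a) e (suc i) = shiftℕ-cong a e i

shiftℕ-+ : ∀ a (f g : ℕ → ℤ) i → shiftℕ a (λ k → f k ℤ.+ g k) i ≡ shiftℕ a f i ℤ.+ shiftℕ a g i
shiftℕ-+ zero    f g i       = refl
shiftℕ-+ (suc a) f g zero    = refl
shiftℕ-+ (suc a) f g (suc i) = shiftℕ-+ a f g i

shiftℕ-zero : ∀ a i → shiftℕ a (λ _ → + 0) i ≡ + 0
shiftℕ-zero zero    i       = refl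
shiftℕ-zero (suc a) zero    = refl
shiftℕ-zero (suc a) (suc i) = shiftℕ-zero a i

shiftℕ-indicator : ∀ a c (f : Bool → ℤ) → f false ≡ + 0 → ∀ i →
  shiftℕ a (λ k → f (c ≡ᵇ k)) i ≡ f ((a ℕ.+ c) ≡ᵇ i)
shiftℕ-indicator zero    c f f0 i       = refl
shiftℕ-indicator (suc a) c f f0 zero    = sym f0
shiftℕ-indicator (suc a) c f f0 (suc i) = shiftℕ-indicator a c f f0 i

Σ<-pick : ∀ a i (h : ℕ → ℤ) → Σ< (suc i) (λ k → if a ≡ᵇ k then h (i ∸ k) else + 0) ≡ shiftℕ a h i
Σ<-pick zero    i       h = trans (cong (ℤ._+_ (h i)) (Σ<-zero i)) (+ℤ-identityʳ (h i))
Σ<-pick (suc a) zero    h = refl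
Σ<-pick (suc a) (suc i) h = trans (+ℤ-identityˡ _) (Σ<-pick a i h)

-- x^a y^b · p
shift : ℕ → ℕ → Poly → Poly
shift a b p i j = shiftℕ a (λ i' → shiftℕ b (p i') j) i

cauchy-term : Poly → Poly → ℕ → ℕ → ℕ → ℕ → ℤ
cauchy-term p q i j a b = p a b ℤ.* q (i ∸ a) (j ∸ b)

*ₚ-coeff : ∀ p q i j → (p *ₚ q) i j ≡ Σ< (suc i) (λ a → Σ< (suc j) (cauchy-term p q i j a))
*ₚ-coeff p q i j =
  trans (cong sumℤ (map-upTo (λ a → sumℤ (map (cauchy-term p q i j a) (upTo (suc j)))) (suc i)))
        (Σ<-cong (suc i) (λ a → cong sumℤ (map-upTo (cauchy-term p q i j a) (suc j))))

mono-*ₚ : ∀ a b q → mono a b *ₚ q ≈ₚ shift a b q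
mono-*ₚ a b q i j = begin
  (mono a b *ₚ q) i j
    ≡⟨ *ₚ-coeff (mono a b) q i j ⟩
  Σ< (suc i) (λ a' → Σ< (suc j) (cauchy-term (mono a b) q i j a'))
    ≡⟨ Σ<-cong (suc i) (λ a' → trans (Σ<-cong (suc j) (λ b' → guarded (a ≡ᵇ a') (b ≡ᵇ b') (q (i ∸ a') (j ∸ b'))))
                                     (Σ<-guard (suc j) (a ≡ᵇ a') (picked a'))) ⟩
  Σ< (suc i) (λ a' → if a ≡ᵇ a' then Σ< (suc j) (picked a') else + 0)
    ≡⟨ Σ<-cong (suc i) (λ a' → cong (λ s → if a ≡ᵇ a' then s else + 0) (Σ<-pick b j (q (i ∸ a')))) ⟩
  Σ< (suc i) (λ a' → if a ≡ᵇ a' then shiftℕ b (q (i ∸ a')) j else + 0)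
    ≡⟨ Σ<-pick a i (λ i' → shiftℕ b (q i') j) ⟩
  shift a b q i j ∎
  where
  open ≡-Reasoning
  picked : ℕ → ℕ → ℤ
  picked a' b' = if b ≡ᵇ b' then q (i ∸ a') (j ∸ b') else + 0
  guarded : ∀ c d r → (if c ∧ d then + 1 else + 0) ℤ.* r ≡ (if c then (if d then r else + 0) else + 0)
  guarded true  true  r = *-identityˡ r
  guarded true  false r = refl
  guarded false d     r = refl

*ₚ-congˡ : ∀ {p p'} q → p ≈ₚ p' → p *ₚ q ≈ₚ p' *ₚ q
*ₚ-congˡ {p} {p'} q p≈p' i j = trans (*ₚ-coeff p q i j) (trans
  (Σ<-cong (suc i) (λ a → Σ<-cong (suc j) (λ b → cong (ℤ._* q (i ∸ a) (j ∸ b)) (p≈p' a b))))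
  (sym (*ₚ-coeff p' q i j)))

*ₚ-distribʳ-+ₚ : ∀ p p' q → (p +ₚ p') *ₚ q ≈ₚ p *ₚ q +ₚ p' *ₚ q
*ₚ-distribʳ-+ₚ p p' q i j = trans (*ₚ-coeff (p +ₚ p') q i j) (trans
  (trans (Σ<-cong (suc i) (λ a → trans (Σ<-cong (suc j) (λ b → distrib (p a b) (p' a b) (q (i ∸ a) (j ∸ b))))
                                       (Σ<-+ (suc j) (cauchy-term p q i j a) (cauchy-term p' q i j a))))
         (Σ<-+ (suc i) (λ a → Σ< (suc j) (cauchy-term p q i j a)) (λ a → Σ< (suc j) (cauchy-term p' q i j a))))
  (sym (cong₂ ℤ._+_ (*ₚ-coeff p q i j) (*ₚ-coeff p' q i j))))
  where
  distrib : ∀ x y r → (x ℤ.+ y) ℤ.* r ≡ x ℤ.* r ℤ.+ y ℤ.* r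
  distrib = solve-∀

*ₚ-distribʳ-diffₚ : ∀ p p' q → (p -ₚ p') *ₚ q ≈ₚ p *ₚ q -ₚ p' *ₚ q
*ₚ-distribʳ-diffₚ p p' q i j = trans (*ₚ-coeff (p -ₚ p') q i j) (trans
  (trans (Σ<-cong (suc i) (λ a → trans (Σ<-cong (suc j) (λ b → distrib (p a b) (p' a b) (q (i ∸ a) (j ∸ b))))
                                       (Σ<-diff (suc j) (cauchy-term p q i j a) (cauchy-term p' q i j a))))
         (Σ<-diff (suc i) (λ a → Σ< (suc j) (cauchy-term p q i j a)) (λ a → Σ< (suc j) (cauchy-term p' q i j a))))
  (sym (cong₂ ℤ._-_ (*ₚ-coeff p q i j) (*ₚ-coeff p' q i j))))
  where
  distrib : ∀ x y r → (x ℤ.- y) ℤ.* r ≡ x ℤ.* r ℤ.- y ℤ.* r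
  distrib = solve-∀


one+x-*ₚ : ∀ p → (1ₚ +ₚ xₚ) *ₚ p ≈ₚ p +ₚ shift 1 0 p
one+x-*ₚ p = ≈ₚ-trans (*ₚ-distribʳ-+ₚ 1ₚ xₚ p) (+ₚ-cong (mono-*ₚ 0 0 p) (mono-*ₚ 1 0 p))

x[y-1]-*ₚ : ∀ p → (xₚ *ₚ (yₚ -ₚ 1ₚ)) *ₚ p ≈ₚ shift 1 1 p -ₚ shift 1 0 p
x[y-1]-*ₚ p = ≈ₚ-trans (*ₚ-congˡ p (≈ₚ-trans (mono-*ₚ 1 0 (yₚ -ₚ 1ₚ)) expand))
             (≈ₚ-trans (*ₚ-distribʳ-diffₚ (mono 1 1) (mono 1 0) p) (-ₚ-cong (mono-*ₚ 1 1 p) (mono-*ₚ 1 0 p)))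
  where
  expand : shift 1 0 (yₚ -ₚ 1ₚ) ≈ₚ mono 1 1 -ₚ mono 1 0
  expand zero    j = refl
  expand (suc i) j = refl

shift-+ₚ : ∀ a b p q → shift a b (p +ₚ q) ≈ₚ shift a b p +ₚ shift a b q
shift-+ₚ a b p q i j =
  trans (shiftℕ-cong a (λ i' → shiftℕ-+ b (p i') (q i') j) i)
        (shiftℕ-+ a (λ i' → shiftℕ b (p i') j) (λ i' → shiftℕ b (q i') j) i)

shift-0ₚ : ∀ a b → shift a b 0ₚ ≈ₚ 0ₚ
shift-0ₚ a b i j = trans (shiftℕ-cong a (λ i' → shiftℕ-zero b j) i) (shiftℕ-zero a i)

shift-sumₚ : ∀ {A : Set} a b (F : A → Poly) (L : List A) →
  shift a b (sumₚ (map F L)) ≈ₚ sumₚ (map (λ X → shift a b (F X)) L)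
shift-sumₚ a b F []      = shift-0ₚ a b
shift-sumₚ a b F (X ∷ L) = ≈ₚ-trans (shift-+ₚ a b (F X) (sumₚ (map F L)))
                                    (+ₚ-cong (≈ₚ-refl {shift a b (F X)}) (shift-sumₚ a b F L))

shift-mono : ∀ a b c d → shift a b (mono c d) ≈ₚ mono (a ℕ.+ c) (b ℕ.+ d)
shift-mono a b c d i j =
  trans (shiftℕ-cong a (λ i' → shiftℕ-indicator b d (λ e → unit ((c ≡ᵇ i') ∧ e))
                                                  (cong unit (∧-zeroʳ (c ≡ᵇ i'))) j) i)
        (shiftℕ-indicator a c (λ e → unit (e ∧ ((b ℕ.+ d) ≡ᵇ j))) refl i)
  where
  unit : Bool → ℤ
  unit e = if e then + 1 else + 0

sumₚ-map-cong : ∀ {A : Set} {F F' : A → Poly} (L : List A) → (∀ X → F X ≈ₚ F' X) →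
  sumₚ (map F L) ≈ₚ sumₚ (map F' L)
sumₚ-map-cong []      e = ≈ₚ-refl
sumₚ-map-cong (X ∷ L) e = +ₚ-cong (e X) (sumₚ-map-cong L e)

+ₚ-interchange : ∀ p q r s → (p +ₚ q) +ₚ (r +ₚ s) ≈ₚ (p +ₚ r) +ₚ (q +ₚ s)
+ₚ-interchange p q r s i j = ℤ-interchange (p i j) (q i j) (r i j) (s i j)

Σsubsets : (n : ℕ) → (VSet n → Poly) → Poly
Σsubsets n F = sumₚ (map F (subsets n))

Σ-doubled : ∀ {m} (L : List (VSet m)) (F : VSet (suc m) → Poly) →
  sumₚ (map F (concatMap (λ S → extend false S ∷ extend true S ∷ []) L)) ≈ₚ
  sumₚ (map (λ S → F (extend false S)) L) +ₚ sumₚ (map (λ S → F (extend true S)) L)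
Σ-doubled []      F i j = refl
Σ-doubled (S ∷ L) F i j = trans
  (cong (λ z → F (extend false S) i j ℤ.+ (F (extend true S) i j ℤ.+ z)) (Σ-doubled L F i j))
  (regroup (F (extend false S) i j) (F (extend true S) i j)
           (sumₚ (map (λ S → F (extend false S)) L) i j) (sumₚ (map (λ S → F (extend true S)) L) i j))
  where
  regroup : ∀ a b c d → a ℤ.+ (b ℤ.+ (c ℤ.+ d)) ≡ (a ℤ.+ c) ℤ.+ (b ℤ.+ d)
  regroup = solve-∀

Σsubsets-split : (v : Fin (suc m)) (F : VSet (suc m) → Poly) →
  Σsubsets (suc m) F ≈ₚ Σsubsets m (λ Y → F (ins v false Y)) +ₚ Σsubsets m (λ Y → F (ins v true Y))
Σsubsets-split {m} zero F = Σ-doubled (subsets m) F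
Σsubsets-split {suc m} (suc v) F = begin
  Σsubsets (suc (suc m)) F
    ≈⟨ Σ-doubled (subsets (suc m)) F ⟩
  Σsubsets (suc m) (λ S → F (extend false S)) +ₚ Σsubsets (suc m) (λ S → F (extend true S))
    ≈⟨ +ₚ-cong (Σsubsets-split v (λ S → F (extend false S))) (Σsubsets-split v (λ S → F (extend true S))) ⟩
  (Σ false false +ₚ Σ false true) +ₚ (Σ true false +ₚ Σ true true)
    ≈⟨ +ₚ-interchange (Σ false false) (Σ false true) (Σ true false) (Σ true true) ⟩
  (Σ false false +ₚ Σ true false) +ₚ (Σ false true +ₚ Σ true true)
    ≈⟨ ≈ₚ-sym (+ₚ-cong (Σ-doubled (subsets m) (λ Y → F (ins (suc v) false Y)))
                       (Σ-doubled (subsets m) (λ Y → F (ins (suc v) true Y)))) ⟩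
  Σsubsets (suc m) (λ Y → F (ins (suc v) false Y)) +ₚ Σsubsets (suc m) (λ Y → F (ins (suc v) true Y)) ∎
  where
  open ≈ₚ-Reasoning
  Σ : Bool → Bool → Poly
  Σ zero∈ v∈ = Σsubsets m (λ Z → F (extend zero∈ (ins v v∈ Z)))

shift-Σsubsets : ∀ a b (s c : VSet n → ℕ) →
  shift a b (Σsubsets n (λ X → mono (s X) (c X))) ≈ₚ Σsubsets n (λ X → mono (a + s X) (b + c X))
shift-Σsubsets {n} a b s c = ≈ₚ-trans (shift-sumₚ a b (λ X → mono (s X) (c X)) (subsets n))
                                      (sumₚ-map-cong (subsets n) (λ X → shift-mono a b (s X) (c X)))

module LeafRecurrence {n : ℕ} (G : Graph (suc (suc n))) (v w : Fin (suc (suc n)))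
                      (deg : degree G v ≡ 1) (e : adj G v w ≡ true) where

  open LeafVertex G v w deg e

  H : Graph (suc n)
  H = G -ᵥ v

  K : Graph n
  K = removeTwo G v w (adj⇒≢ G e)

  with-v : Poly
  with-v = Σsubsets (suc n) (λ Y → mono (suc (size Y)) (indicator (not (Y w')) + components H Y))

  with-v-and-w : Poly
  with-v-and-w = Σsubsets n (λ Z → mono (suc (size (ins w' true Z))) (components H (ins w' true Z)))

  Q-split-v : Q G ≈ₚ Q H +ₚ with-v
  Q-split-v = ≈ₚ-trans (Σsubsets-split v (λ X → mono (size X) (components G X)))
    (+ₚ-cong (sumₚ-map-cong (subsets (suc n)) (λ Y → mono-cong (size-ins v false Y) (components-absent G v Y)))
             (sumₚ-map-cong (subsets (suc n)) (λ Y → mono-cong (size-ins v true Y) (components-leaf Y))))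

  -- Split the terms with v according to whether w ∈ Y; without w, v is a
  -- component of its own.
  with-v-split : with-v ≈ₚ Σsubsets n (λ Z → mono (suc (size Z)) (suc (components K Z))) +ₚ with-v-and-w
  with-v-split = ≈ₚ-trans (Σsubsets-split w' _)
    (+ₚ-cong (sumₚ-map-cong (subsets n) (λ Z → mono-cong (cong suc (size-ins w' false Z))
                (cong₂ (λ b k → indicator (not b) + k) (ins-at w' false Z) (components-absent H w' Z))))
             (sumₚ-map-cong (subsets n) (λ Z → mono-cong {a = suc (size (ins w' true Z))} refl
                (cong (λ b → indicator (not b) + components H (ins w' true Z)) (ins-at w' true Z)))))

  xQH-split : shift 1 0 (Q H) ≈ₚ Σsubsets n (λ Z → mono (suc (size Z)) (components K Z)) +ₚ with-v-and-w
  xQH-split = ≈ₚ-trans (shift-Σsubsets 1 0 size (components H))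
    (≈ₚ-trans (Σsubsets-split w' _)
      (+ₚ-cong (sumₚ-map-cong (subsets n) (λ Z → mono-cong (cong suc (size-ins w' false Z)) (components-absent H w' Z)))
               ≈ₚ-refl))

corollary5p3 : ∀ {n} (G : Graph (suc (suc n))) (v w : Fin (suc (suc n)))
    → degree G v ≡ 1 → (e : adj G v w ≡ true)
    → Q G ≈ₚ (1ₚ +ₚ xₚ) *ₚ Q (G -ᵥ v)
    +ₚ (xₚ *ₚ (yₚ -ₚ 1ₚ)) *ₚ Q (removeTwo G v w (adj⇒≢ G e))
corollary5p3 {n} G v w deg e = begin
  Q G
    ≈⟨ Q-split-v ⟩
  Q H +ₚ with-v
    ≈⟨ +ₚ-cong (≈ₚ-refl {Q H}) with-v-split ⟩
  Q H +ₚ (xyQK +ₚ with-v-and-w)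
    ≈⟨ (λ i j → regroup (Q H i j) (xQK i j) (xyQK i j) (with-v-and-w i j)) ⟩
  (Q H +ₚ (xQK +ₚ with-v-and-w)) +ₚ (xyQK -ₚ xQK)
    ≈⟨ ≈ₚ-sym (+ₚ-cong (+ₚ-cong (≈ₚ-refl {Q H}) xQH-split)
                       (-ₚ-cong (shift-Σsubsets 1 1 size (components K)) (shift-Σsubsets 1 0 size (components K)))) ⟩
  (Q H +ₚ shift 1 0 (Q H)) +ₚ (shift 1 1 (Q K) -ₚ shift 1 0 (Q K))
    ≈⟨ ≈ₚ-sym (+ₚ-cong (one+x-*ₚ (Q H)) (x[y-1]-*ₚ (Q K))) ⟩
  (1ₚ +ₚ xₚ) *ₚ Q H +ₚ (xₚ *ₚ (yₚ -ₚ 1ₚ)) *ₚ Q K ∎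
  where
  open ≈ₚ-Reasoning
  open LeafRecurrence G v w deg e
  -- x Q(K) and x y Q(K), written as subset sums
  xQK xyQK : Poly
  xQK  = Σsubsets n (λ Z → mono (suc (size Z)) (components K Z))
  xyQK = Σsubsets n (λ Z → mono (suc (size Z)) (suc (components K Z)))
  regroup : ∀ h a a' b → h ℤ.+ (a' ℤ.+ b) ≡ (h ℤ.+ (a ℤ.+ b)) ℤ.+ (a' ℤ.- a)
  regroup = solve-∀
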